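{- Let $n\ge2$ and let $\mathcal{P}_n$ be the geometric lattice of rank two with $n$ atoms (the lattice of flats of the uniform matroid $U_{2,n}$: a minimum $\hat0$, a maximum $\hat1$, and $n$ pairwise incomparable atoms). Then $\mathcal{M}(\mathcal{P}_n,t)=(t^2-nt+1)(t+1)^2(t-1)^2$.
   Context: For a ranked finite poset $\mathcal{S}$ with rank function $\mathrm{rk}$ and rank $\mathrm{rk}(\mathcal{S})$, $\mathcal{F}l^3(\mathcal{S})=\{(x,y,z):x\le y\le z\}$, $J$ is defined on $\mathcal{F}l^3(\mathcal{S})$ by $\sum_{x\le a\le y\le b\le z}J(a,y,b)=\delta_3(x,y,z)$ ($\delta_3(x,y,z)=1$ iff $x=y=z$, else $0$), and $\mathcal{M}(\mathcal{S},t)=\sum_{(x,y,z)\in\mathcal{F}l^3(\mathcal{S})}J(x,y,z)\,t^{3\mathrm{rk}(\mathcal{S})-\mathrm{rk}(x)-\mathrm{rk}(y)-\mathrm{rk}(z)}$. -}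

module Defs where

open import Data.Nat using (ℕ; zero; suc; _∸_) renaming (_*_ to _*ℕ_)
open import Data.Integer using (ℤ; +_; _+_; _*_; _^_; 0ℤ; 1ℤ)
open import Data.Fin using (Fin)
import Data.Fin.Properties as FinP
open import Data.List using (List; []; _∷_; _++_; map; allFin; foldr)
open import Data.Product using (_×_; _,_)
open import Relation.Nullary using (Dec; yes; no; ¬_)
open import Relation.Binary.PropositionalEquality using (_≡_; refl; cong)
open import Relation.Binary.Definitions using (Decidable)

record FinRankedPoset : Set₁ where
  field
    Carrier : Set
    elems   : List Carrier          -- every element listed exactly once
    _≤_     : Carrier → Carrier → Set
    _≤?_    : Decidable _≤_
    _≟_     : Decidable {A = Carrier} _≡_
    rk      : Carrier → ℕ
    rank    : ℕ

sumL : {A : Set} → List A → (A → ℤ) → ℤ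
sumL xs f = foldr (λ a acc → f a + acc) 0ℤ xs

⟦_⟧ : {P : Set} → Dec P → ℤ
⟦ yes _ ⟧ = 1ℤ
⟦ no _ ⟧  = 0ℤ

module _ (S : FinRankedPoset) where
  open FinRankedPoset S

  δ₃ : Carrier → Carrier → Carrier → ℤ
  δ₃ x y z = ⟦ x ≟ y ⟧ * ⟦ y ≟ z ⟧

  -- J : Fl³(S) → ℤ (given as a function on all triples; only values on
  -- flags x ≤ y ≤ z enter) satisfies the defining relation
  --   Σ_{x ≤ a ≤ y ≤ b ≤ z} J(a,y,b) = δ₃(x,y,z)  for all (x,y,z) ∈ Fl³(S).
  IsJ : (Carrier → Carrier → Carrier → ℤ) → Set
  IsJ J = ∀ x y z → x ≤ y → y ≤ z →
    sumL elems (λ a → sumL elems (λ b →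
      ⟦ x ≤? a ⟧ * ⟦ a ≤? y ⟧ * ⟦ y ≤? b ⟧ * ⟦ b ≤? z ⟧ * J a y b))
    ≡ δ₃ x y z

  M : (Carrier → Carrier → Carrier → ℤ) → ℤ → ℤ
  M J t = sumL elems (λ x → sumL elems (λ y → sumL elems (λ z →
    ⟦ x ≤? y ⟧ * ⟦ y ≤? z ⟧ * J x y z
      * (t ^ (3 *ℕ rank ∸ rk x ∸ rk y ∸ rk z)))))

data PElt (n : ℕ) : Set where
  bot  : PElt n
  atom : Fin n → PElt n
  top  : PElt n

data _≤P_ {n : ℕ} : PElt n → PElt n → Set where
  bot≤     : ∀ {x} → bot ≤P x
  ≤top     : ∀ {x} → x ≤P top
  atom≤atom : ∀ {i} → atom i ≤P atom i

_≤P?_ : ∀ {n} → Decidable (_≤P_ {n})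
bot ≤P? y = yes bot≤
atom i ≤P? bot = no (λ ())
atom i ≤P? atom j with FinP._≟_ i j
... | yes refl = yes atom≤atom
... | no i≢j = no λ { atom≤atom → i≢j refl }
atom i ≤P? top = yes ≤top
top ≤P? bot = no (λ ())
top ≤P? atom j = no (λ ())
top ≤P? top = yes ≤top

atom-inj : ∀ {n} {i j : Fin n} → atom i ≡ atom j → i ≡ j
atom-inj refl = refl

_≟P_ : ∀ {n} → Decidable {A = PElt n} _≡_
bot ≟P bot = yes refl
bot ≟P atom j = no (λ ())
bot ≟P top = no (λ ())
atom i ≟P bot = no (λ ())
atom i ≟P atom j with FinP._≟_ i j
... | yes refl = yes refl
... | no i≢j = no (λ e → i≢j (atom-inj e))
atom i ≟P top = no (λ ())
top ≟P bot = no (λ ())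
top ≟P atom j = no (λ ())
top ≟P top = yes refl

rkP : ∀ {n} → PElt n → ℕ
rkP bot = 0
rkP (atom _) = 1
rkP top = 2

P : ℕ → FinRankedPoset
P n = record
  { Carrier = PElt n
  ; elems   = bot ∷ map atom (allFin n) ++ (top ∷ [])
  ; _≤_     = _≤P_
  ; _≤?_    = _≤P?_
  ; _≟_     = _≟P_
  ; rk      = rkP
  ; rank    = 2
  }

-- The solution of the defining relation is J(a, y, b) = μ(a, y) μ(y, b), where μ is the Möbius
-- function of P_n: for this J the double sum over [x, y] × [y, z] in the relation factors as
-- (Σ_{a ∈ [x,y]} μ(a, y)) (Σ_{b ∈ [y,z]} μ(y, b)) = δ(x, y) δ(y, z).  The relation is triangular
-- (the flag (x, y, z) itself enters with coefficient 1, every other term lives on a smaller flag),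
-- so any two solutions agree on flags, which is all M sees.  Evaluating M on μ(a, y) μ(y, b)
-- is then a polynomial identity in n and t.
module Submission where

open import Defs
open import Data.Nat using (ℕ; _≤_; zero; suc; _∸_) renaming (_*_ to _*ℕ_)
open import Data.Integer using (ℤ; +_; _+_; _-_; _*_; _^_; 0ℤ; 1ℤ; -1ℤ)
open import Data.Integer.Properties
  using (+-identityˡ; +-identityʳ; +-assoc; +-comm; suc-*; *-identityˡ; *-identityʳ;
         *-zeroˡ; *-zeroʳ; *-distribˡ-+; *-distribʳ-+; +-0-abelianGroup)
open import Data.Integer.Tactic.RingSolver using (solve-∀)
open import Data.Integer.Solver using (module +-*-Solver)
open +-*-Solver using (solve; _:=_; con; _:+_; _:*_; _:-_; _:^_)
open import Algebra.Bundles using (AbelianGroup)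
open import Algebra.Properties.Group (AbelianGroup.group +-0-abelianGroup) using (∙-cancelˡ; ∙-cancelʳ)
open import Data.Fin using (Fin) renaming (zero to fzero; suc to fsuc)
import Data.Fin.Properties as Fin
open import Data.List using (List; []; _∷_; _++_; map; allFin)
open import Data.List.Properties using (map-tabulate)
open import Data.Product using (Σ; _×_; _,_)
open import Relation.Nullary using (yes; no; contradiction)
open import Relation.Binary.PropositionalEquality
  using (_≡_; _≢_; refl; sym; trans; cong; cong₂; module ≡-Reasoning)
open ≡-Reasoning

+-cancelˡ′ : ∀ {a a′ b b′ : ℤ} → a ≡ a′ → a + b ≡ a′ + b′ → b ≡ b′
+-cancelˡ′ {a} refl = ∙-cancelˡ a _ _

+-cancelʳ′ : ∀ {a a′ b b′ : ℤ} → b ≡ b′ → a + b ≡ a′ + b′ → a ≡ a′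
+-cancelʳ′ {b = b} refl = ∙-cancelʳ b _ _

module _ {A : Set} where

  sumL-cong : (xs : List A) {f g : A → ℤ} → (∀ a → f a ≡ g a) → sumL xs f ≡ sumL xs g
  sumL-cong []       f≗g = refl
  sumL-cong (x ∷ xs) f≗g = cong₂ _+_ (f≗g x) (sumL-cong xs f≗g)

  sumL-zero : (xs : List A) {f : A → ℤ} → (∀ a → f a ≡ 0ℤ) → sumL xs f ≡ 0ℤ
  sumL-zero []       f≗0 = refl
  sumL-zero (x ∷ xs) f≗0 = cong₂ _+_ (f≗0 x) (sumL-zero xs f≗0)

  sumL-++ : (xs ys : List A) (f : A → ℤ) → sumL (xs ++ ys) f ≡ sumL xs f + sumL ys f
  sumL-++ []       ys f = sym (+-identityˡ _)
  sumL-++ (x ∷ xs) ys f = trans (cong (_+_ (f x)) (sumL-++ xs ys f)) (sym (+-assoc (f x) _ _))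

  sumL-map : {B : Set} (h : B → A) (xs : List B) (f : A → ℤ) →
             sumL (map h xs) f ≡ sumL xs (λ b → f (h b))
  sumL-map h []       f = refl
  sumL-map h (x ∷ xs) f = cong (_+_ (f (h x))) (sumL-map h xs f)

  sumL-*ˡ : (xs : List A) (c : ℤ) (f : A → ℤ) → sumL xs (λ a → c * f a) ≡ c * sumL xs f
  sumL-*ˡ []       c f = sym (*-zeroʳ c)
  sumL-*ˡ (x ∷ xs) c f = trans (cong (_+_ (c * f x)) (sumL-*ˡ xs c f)) (sym (*-distribˡ-+ c (f x) _))

  sumL-*ʳ : (xs : List A) (c : ℤ) (f : A → ℤ) → sumL xs (λ a → f a * c) ≡ sumL xs f * c
  sumL-*ʳ []       c f = sym (*-zeroˡ c)
  sumL-*ʳ (x ∷ xs) c f = trans (cong (_+_ (f x * c)) (sumL-*ʳ xs c f)) (sym (*-distribʳ-+ c (f x) _))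

  sumL-*-sumL : (xs ys : List A) (f g : A → ℤ) →
                sumL xs (λ a → sumL ys (λ b → f a * g b)) ≡ sumL xs f * sumL ys g
  sumL-*-sumL xs ys f g = trans (sumL-cong xs (λ a → sumL-*ˡ ys (f a) g)) (sumL-*ʳ xs (sumL ys g) f)

sumL-allFin-suc : ∀ n (f : Fin (suc n) → ℤ) →
                  sumL (allFin (suc n)) f ≡ f fzero + sumL (allFin n) (λ j → f (fsuc j))
sumL-allFin-suc n f = cong (_+_ (f fzero))
  (trans (cong (λ xs → sumL xs f) (sym (map-tabulate (λ j → j) fsuc))) (sumL-map fsuc (allFin n) f))

sumL-allFin-const : ∀ n (c : ℤ) → sumL (allFin n) (λ _ → c) ≡ + n * c
sumL-allFin-const zero    c = refl
sumL-allFin-const (suc n) c = begin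
  sumL (allFin (suc n)) (λ _ → c) ≡⟨ sumL-allFin-suc n (λ _ → c) ⟩
  c + sumL (allFin n) (λ _ → c)   ≡⟨ cong (_+_ c) (sumL-allFin-const n c) ⟩
  c + + n * c                     ≡⟨ suc-* (+ n) c ⟨
  + suc n * c                     ∎

sumL-allFin-single : ∀ {n} (i : Fin n) (f : Fin n → ℤ) → (∀ j → j ≢ i → f j ≡ 0ℤ) →
                     sumL (allFin n) f ≡ f i
sumL-allFin-single {suc n} fzero f off = begin
  sumL (allFin (suc n)) f
    ≡⟨ sumL-allFin-suc n f ⟩
  f fzero + sumL (allFin n) (λ j → f (fsuc j))
    ≡⟨ cong (_+_ (f fzero)) (sumL-zero (allFin n) (λ j → off (fsuc j) λ ())) ⟩
  f fzero + 0ℤ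
    ≡⟨ +-identityʳ _ ⟩
  f fzero
    ∎
sumL-allFin-single {suc n} (fsuc i) f off = begin
  sumL (allFin (suc n)) f
    ≡⟨ sumL-allFin-suc n f ⟩
  f fzero + sumL (allFin n) (λ j → f (fsuc j))
    ≡⟨ cong₂ _+_ (off fzero λ ())
                 (sumL-allFin-single i _ λ j j≢i → off (fsuc j) (λ eq → j≢i (Fin.suc-injective eq))) ⟩
  0ℤ + f (fsuc i)
    ≡⟨ +-identityˡ _ ⟩
  f (fsuc i)
    ∎

module _ (S : FinRankedPoset) where
  open FinRankedPoset S renaming (_≤_ to _≼_)

  M-cong-flags : (J J′ : Carrier → Carrier → Carrier → ℤ) →
                 (∀ {x y z} → x ≼ y → y ≼ z → J x y z ≡ J′ x y z) →
                 ∀ t → M S J t ≡ M S J′ t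
  M-cong-flags J J′ agree t =
    sumL-cong elems λ x → sumL-cong elems λ y → sumL-cong elems λ z → on-flags x y z
    where
    on-flags : ∀ x y z → ⟦ x ≤? y ⟧ * ⟦ y ≤? z ⟧ * J x y z * t ^ (3 *ℕ rank ∸ rk x ∸ rk y ∸ rk z)
                       ≡ ⟦ x ≤? y ⟧ * ⟦ y ≤? z ⟧ * J′ x y z * t ^ (3 *ℕ rank ∸ rk x ∸ rk y ∸ rk z)
    on-flags x y z with x ≤? y | y ≤? z
    ... | yes x≤y | yes y≤z = cong (λ w → 1ℤ * w * _) (agree x≤y y≤z)
    ... | yes _   | no _    = refl
    ... | no _    | _       = refl

module RankTwo (n : ℕ) where
  open FinRankedPoset (P n) using (elems)

  atoms : List (PElt n)
  atoms = map atom (allFin n)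

  ζ : PElt n → PElt n → ℤ
  ζ x y = ⟦ x ≤P? y ⟧

  sumL-elems : (f : PElt n → ℤ) → sumL elems f ≡ f bot + (f top + sumL atoms f)
  sumL-elems f = cong (_+_ (f bot)) (begin
    sumL (atoms ++ top ∷ []) f     ≡⟨ sumL-++ atoms (top ∷ []) f ⟩
    sumL atoms f + (f top + 0ℤ)    ≡⟨ cong (_+_ (sumL atoms f)) (+-identityʳ (f top)) ⟩
    sumL atoms f + f top           ≡⟨ +-comm (sumL atoms f) (f top) ⟩
    f top + sumL atoms f           ∎)

  sumL-atoms-cong : {f g : PElt n → ℤ} → (∀ j → f (atom j) ≡ g (atom j)) → sumL atoms f ≡ sumL atoms g
  sumL-atoms-cong {f} {g} f≗g =
    trans (sumL-map atom (allFin n) f) (trans (sumL-cong (allFin n) f≗g) (sym (sumL-map atom (allFin n) g)))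

  sumL-atoms-const : (f : PElt n → ℤ) (c : ℤ) → (∀ j → f (atom j) ≡ c) → sumL atoms f ≡ + n * c
  sumL-atoms-const f c f≗c =
    trans (sumL-map atom (allFin n) f) (trans (sumL-cong (allFin n) f≗c) (sumL-allFin-const n c))

  sumL-atoms-zero : (f : PElt n → ℤ) → (∀ j → f (atom j) ≡ 0ℤ) → sumL atoms f ≡ 0ℤ
  sumL-atoms-zero f f≗0 = trans (sumL-map atom (allFin n) f) (sumL-zero (allFin n) f≗0)

  sumL-atoms-single : (f : PElt n → ℤ) (i : Fin n) → (∀ j → j ≢ i → f (atom j) ≡ 0ℤ) →
                      sumL atoms f ≡ f (atom i)
  sumL-atoms-single f i off =
    trans (sumL-map atom (allFin n) f) (sumL-allFin-single i (λ j → f (atom j)) off)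

  ζ-top : ∀ x → ζ x top ≡ 1ℤ
  ζ-top bot      = refl
  ζ-top (atom _) = refl
  ζ-top top      = refl

  ζ-atom-refl : ∀ i → ζ (atom i) (atom i) ≡ 1ℤ
  ζ-atom-refl i with i Fin.≟ i
  ... | yes refl = refl
  ... | no i≢i   = contradiction refl i≢i

  ζ-atom-≢ : ∀ {i j} → i ≢ j → ζ (atom i) (atom j) ≡ 0ℤ
  ζ-atom-≢ {i} {j} i≢j with i Fin.≟ j
  ... | yes i≡j = contradiction i≡j i≢j
  ... | no _    = refl

  δ-refl : (x : PElt n) → ⟦ x ≟P x ⟧ ≡ 1ℤ
  δ-refl bot = refl
  δ-refl (atom i) with i Fin.≟ i
  ... | yes refl = refl
  ... | no i≢i   = contradiction refl i≢i
  δ-refl top = refl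

  -- The interval [x, y] for x ≤ y; for two distinct atoms the value is junk.
  interval : PElt n → PElt n → List (PElt n)
  interval bot      bot      = bot ∷ []
  interval bot      (atom i) = bot ∷ atom i ∷ []
  interval bot      top      = bot ∷ top ∷ atoms
  interval (atom i) (atom _) = atom i ∷ []
  interval (atom i) top      = atom i ∷ top ∷ []
  interval top      top      = top ∷ []
  interval _        _        = []

  sumL-interval-bot-top : (g : PElt n → ℤ) →
                          sumL elems (λ a → ζ bot a * ζ a top * g a) ≡ sumL (interval bot top) g
  sumL-interval-bot-top g = begin
    sumL elems (λ a → ζ bot a * ζ a top * g a)
      ≡⟨ sumL-elems (λ a → ζ bot a * ζ a top * g a) ⟩
    1ℤ * g bot + (1ℤ * g top + sumL atoms (λ a → 1ℤ * ζ a top * g a))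
      ≡⟨ cong₂ _+_ (*-identityˡ (g bot)) (cong₂ _+_ (*-identityˡ (g top)) atoms-part) ⟩
    g bot + (g top + sumL atoms g)
      ∎
    where
    atoms-part : sumL atoms (λ a → 1ℤ * ζ a top * g a) ≡ sumL atoms g
    atoms-part = sumL-atoms-cong {f = λ a → 1ℤ * ζ a top * g a} {g = g} λ j → *-identityˡ (g (atom j))

  sumL-interval : ∀ {x y} → x ≤P y → (g : PElt n → ℤ) →
                  sumL elems (λ a → ζ x a * ζ a y * g a) ≡ sumL (interval x y) g
  sumL-interval (bot≤ {bot}) g = begin
    sumL elems (λ a → ζ bot a * ζ a bot * g a)
      ≡⟨ sumL-elems (λ a → ζ bot a * ζ a bot * g a) ⟩
    1ℤ * g bot + (0ℤ + sumL atoms (λ a → 1ℤ * ζ a bot * g a))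
      ≡⟨ cong₂ (λ u s → u + (0ℤ + s)) (*-identityˡ (g bot))
                                      (sumL-atoms-zero (λ a → 1ℤ * ζ a bot * g a) λ _ → refl) ⟩
    g bot + 0ℤ
      ∎
  sumL-interval (bot≤ {atom i}) g = begin
    sumL elems (λ a → ζ bot a * ζ a (atom i) * g a)
      ≡⟨ sumL-elems (λ a → ζ bot a * ζ a (atom i) * g a) ⟩
    1ℤ * g bot + (0ℤ + sumL atoms (λ a → 1ℤ * ζ a (atom i) * g a))
      ≡⟨ cong (λ s → 1ℤ * g bot + (0ℤ + s)) (sumL-atoms-single (λ a → 1ℤ * ζ a (atom i) * g a) i below) ⟩
    1ℤ * g bot + (0ℤ + 1ℤ * ζ (atom i) (atom i) * g (atom i))
      ≡⟨ cong (λ w → 1ℤ * g bot + (0ℤ + 1ℤ * w * g (atom i))) (ζ-atom-refl i) ⟩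
    1ℤ * g bot + (0ℤ + 1ℤ * g (atom i))
      ≡⟨ rearrange (g bot) (g (atom i)) ⟩
    g bot + (g (atom i) + 0ℤ)
      ∎
    where
    below : ∀ j → j ≢ i → 1ℤ * ζ (atom j) (atom i) * g (atom j) ≡ 0ℤ
    below j j≢i = cong (λ w → 1ℤ * w * g (atom j)) (ζ-atom-≢ j≢i)
    rearrange : ∀ a b → 1ℤ * a + (0ℤ + 1ℤ * b) ≡ a + (b + 0ℤ)
    rearrange = solve-∀
  sumL-interval (bot≤ {top}) g = sumL-interval-bot-top g
  sumL-interval (≤top {bot}) g = sumL-interval-bot-top g
  sumL-interval (≤top {atom i}) g = begin
    sumL elems (λ a → ζ (atom i) a * ζ a top * g a)
      ≡⟨ sumL-elems (λ a → ζ (atom i) a * ζ a top * g a) ⟩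
    0ℤ + (1ℤ * g top + sumL atoms (λ a → ζ (atom i) a * ζ a top * g a))
      ≡⟨ cong (λ s → 0ℤ + (1ℤ * g top + s)) (sumL-atoms-single (λ a → ζ (atom i) a * ζ a top * g a) i above) ⟩
    0ℤ + (1ℤ * g top + ζ (atom i) (atom i) * 1ℤ * g (atom i))
      ≡⟨ cong (λ w → 0ℤ + (1ℤ * g top + w * 1ℤ * g (atom i))) (ζ-atom-refl i) ⟩
    0ℤ + (1ℤ * g top + 1ℤ * g (atom i))
      ≡⟨ rearrange (g top) (g (atom i)) ⟩
    g (atom i) + (g top + 0ℤ)
      ∎
    where
    above : ∀ j → j ≢ i → ζ (atom i) (atom j) * 1ℤ * g (atom j) ≡ 0ℤ
    above j j≢i = cong (λ w → w * 1ℤ * g (atom j)) (ζ-atom-≢ (λ i≡j → j≢i (sym i≡j)))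
    rearrange : ∀ b a → 0ℤ + (1ℤ * b + 1ℤ * a) ≡ a + (b + 0ℤ)
    rearrange = solve-∀
  sumL-interval (≤top {top}) g = begin
    sumL elems (λ a → ζ top a * ζ a top * g a)
      ≡⟨ sumL-elems (λ a → ζ top a * ζ a top * g a) ⟩
    0ℤ + (1ℤ * g top + sumL atoms (λ a → ζ top a * ζ a top * g a))
      ≡⟨ cong (λ s → 0ℤ + (1ℤ * g top + s)) (sumL-atoms-zero (λ a → ζ top a * ζ a top * g a) λ _ → refl) ⟩
    0ℤ + (1ℤ * g top + 0ℤ)
      ≡⟨ rearrange (g top) ⟩
    g top + 0ℤ
      ∎
    where
    rearrange : ∀ a → 0ℤ + (1ℤ * a + 0ℤ) ≡ a + 0ℤ
    rearrange = solve-∀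
  sumL-interval (atom≤atom {i}) g = begin
    sumL elems (λ a → ζ (atom i) a * ζ a (atom i) * g a)
      ≡⟨ sumL-elems (λ a → ζ (atom i) a * ζ a (atom i) * g a) ⟩
    0ℤ + (0ℤ + sumL atoms (λ a → ζ (atom i) a * ζ a (atom i) * g a))
      ≡⟨ cong (λ s → 0ℤ + (0ℤ + s)) (sumL-atoms-single (λ a → ζ (atom i) a * ζ a (atom i) * g a) i off) ⟩
    0ℤ + (0ℤ + ζ (atom i) (atom i) * ζ (atom i) (atom i) * g (atom i))
      ≡⟨ cong (λ w → 0ℤ + (0ℤ + w * w * g (atom i))) (ζ-atom-refl i) ⟩
    0ℤ + (0ℤ + 1ℤ * g (atom i))
      ≡⟨ rearrange (g (atom i)) ⟩
    g (atom i) + 0ℤ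
      ∎
    where
    off : ∀ j → j ≢ i → ζ (atom i) (atom j) * ζ (atom j) (atom i) * g (atom j) ≡ 0ℤ
    off j j≢i = cong (λ w → w * ζ (atom j) (atom i) * g (atom j)) (ζ-atom-≢ (λ i≡j → j≢i (sym i≡j)))
    rearrange : ∀ a → 0ℤ + (0ℤ + 1ℤ * a) ≡ a + 0ℤ
    rearrange = solve-∀

  sumL-upset : ∀ x (g : PElt n → ℤ) → sumL elems (λ a → ζ x a * g a) ≡ sumL (interval x top) g
  sumL-upset x g = trans (sumL-cong elems insert-ζ-top) (sumL-interval (≤top {x = x}) g)
    where
    insert-ζ-top : ∀ a → ζ x a * g a ≡ ζ x a * ζ a top * g a
    insert-ζ-top a = sym (trans (cong (λ w → ζ x a * w * g a) (ζ-top a)) (cong (_* g a) (*-identityʳ (ζ x a))))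

  relation-lhs-intervals : (J : PElt n → PElt n → PElt n → ℤ) → ∀ {x y z} → x ≤P y → y ≤P z →
    sumL elems (λ a → sumL elems (λ b → ζ x a * ζ a y * ζ y b * ζ b z * J a y b))
    ≡ sumL (interval x y) (λ a → sumL (interval y z) (λ b → J a y b))
  relation-lhs-intervals J {x} {y} {z} x≤y y≤z = begin
    sumL elems (λ a → sumL elems (λ b → ζ x a * ζ a y * ζ y b * ζ b z * J a y b))
      ≡⟨ sumL-cong elems (λ a → trans (sumL-cong elems (λ b → regroup (ζ x a) (ζ a y) (ζ y b) (ζ b z) (J a y b)))
                                       (sumL-*ˡ elems (ζ x a * ζ a y) (λ b → ζ y b * ζ b z * J a y b))) ⟩
    sumL elems (λ a → ζ x a * ζ a y * sumL elems (λ b → ζ y b * ζ b z * J a y b))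
      ≡⟨ sumL-cong elems (λ a → cong (ζ x a * ζ a y *_) (sumL-interval y≤z (J a y))) ⟩
    sumL elems (λ a → ζ x a * ζ a y * sumL (interval y z) (J a y))
      ≡⟨ sumL-interval x≤y _ ⟩
    sumL (interval x y) (λ a → sumL (interval y z) (λ b → J a y b))
      ∎
    where
    regroup : ∀ a b c d e → a * b * c * d * e ≡ a * b * (c * d * e)
    regroup = solve-∀

  relation-on-intervals : {J : PElt n → PElt n → PElt n → ℤ} → IsJ (P n) J → ∀ {x y z} → x ≤P y → y ≤P z →
    sumL (interval x y) (λ a → sumL (interval y z) (λ b → J a y b)) ≡ δ₃ (P n) x y z
  relation-on-intervals {J} isJ {x} {y} {z} x≤y y≤z =
    trans (sym (relation-lhs-intervals J x≤y y≤z)) (isJ x y z x≤y y≤z)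

  -- The Möbius function of P n; the value at two distinct atoms is junk.
  μ : PElt n → PElt n → ℤ
  μ bot      bot      = 1ℤ
  μ bot      (atom _) = -1ℤ
  μ bot      top      = + n - 1ℤ
  μ (atom _) (atom _) = 1ℤ
  μ (atom _) top      = -1ℤ
  μ top      top      = 1ℤ
  μ _        _        = 0ℤ

  μ-sumˡ-bot-top : sumL (interval bot top) (λ a → μ a top) ≡ 0ℤ
  μ-sumˡ-bot-top =
    trans (cong (λ s → (+ n - 1ℤ) + (1ℤ + s)) (sumL-atoms-const (λ a → μ a top) -1ℤ λ _ → refl)) (cancel (+ n))
    where
    cancel : ∀ m → (m - 1ℤ) + (1ℤ + m * -1ℤ) ≡ 0ℤ
    cancel = solve-∀

  μ-sumʳ-bot-top : sumL (interval bot top) (μ bot) ≡ 0ℤ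
  μ-sumʳ-bot-top =
    trans (cong (λ s → 1ℤ + ((+ n - 1ℤ) + s)) (sumL-atoms-const (μ bot) -1ℤ λ _ → refl)) (cancel (+ n))
    where
    cancel : ∀ m → 1ℤ + ((m - 1ℤ) + m * -1ℤ) ≡ 0ℤ
    cancel = solve-∀

  μ-sumˡ : ∀ {x y} → x ≤P y → sumL (interval x y) (λ a → μ a y) ≡ ⟦ x ≟P y ⟧
  μ-sumˡ (bot≤ {bot})    = refl
  μ-sumˡ (bot≤ {atom _}) = refl
  μ-sumˡ (bot≤ {top})    = μ-sumˡ-bot-top
  μ-sumˡ (≤top {bot})    = μ-sumˡ-bot-top
  μ-sumˡ (≤top {atom _}) = refl
  μ-sumˡ (≤top {top})    = refl
  μ-sumˡ (atom≤atom {i}) = sym (δ-refl (atom i))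

  μ-sumʳ : ∀ {y z} → y ≤P z → sumL (interval y z) (μ y) ≡ ⟦ y ≟P z ⟧
  μ-sumʳ (bot≤ {bot})    = refl
  μ-sumʳ (bot≤ {atom _}) = refl
  μ-sumʳ (bot≤ {top})    = μ-sumʳ-bot-top
  μ-sumʳ (≤top {bot})    = μ-sumʳ-bot-top
  μ-sumʳ (≤top {atom _}) = refl
  μ-sumʳ (≤top {top})    = refl
  μ-sumʳ (atom≤atom {i}) = sym (δ-refl (atom i))

  Jμ : PElt n → PElt n → PElt n → ℤ
  Jμ a y b = μ a y * μ y b

  Jμ-isJ : IsJ (P n) Jμ
  Jμ-isJ x y z x≤y y≤z = begin
    sumL elems (λ a → sumL elems (λ b → ζ x a * ζ a y * ζ y b * ζ b z * Jμ a y b))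
      ≡⟨ relation-lhs-intervals Jμ x≤y y≤z ⟩
    sumL (interval x y) (λ a → sumL (interval y z) (λ b → μ a y * μ y b))
      ≡⟨ sumL-*-sumL (interval x y) (interval y z) (λ a → μ a y) (μ y) ⟩
    sumL (interval x y) (λ a → μ a y) * sumL (interval y z) (μ y)
      ≡⟨ cong₂ _*_ (μ-sumˡ x≤y) (μ-sumʳ y≤z) ⟩
    δ₃ (P n) x y z
      ∎

  module Uniqueness (J J′ : PElt n → PElt n → PElt n → ℤ) (isJ : IsJ (P n) J) (isJ′ : IsJ (P n) J′) where

    relation-sums-agree : ∀ {x y z} → x ≤P y → y ≤P z →
      sumL (interval x y) (λ a → sumL (interval y z) (λ b → J a y b))
      ≡ sumL (interval x y) (λ a → sumL (interval y z) (λ b → J′ a y b))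
    relation-sums-agree x≤y y≤z =
      trans (relation-on-intervals isJ x≤y y≤z) (sym (relation-on-intervals isJ′ x≤y y≤z))

    agree-bbb : J bot bot bot ≡ J′ bot bot bot
    agree-bbb = +-cancelʳ′ refl (+-cancelʳ′ refl (relation-sums-agree bot≤ (bot≤ {x = bot})))

    agree-bba : ∀ i → J bot bot (atom i) ≡ J′ bot bot (atom i)
    agree-bba i = +-cancelʳ′ refl (+-cancelˡ′ agree-bbb
      (+-cancelʳ′ refl (relation-sums-agree bot≤ (bot≤ {x = atom i}))))

    agree-bbt : J bot bot top ≡ J′ bot bot top
    agree-bbt = +-cancelʳ′ (sumL-atoms-cong {f = J bot bot} {g = J′ bot bot} agree-bba) (+-cancelˡ′ agree-bbb
      (+-cancelʳ′ refl (relation-sums-agree bot≤ (bot≤ {x = top}))))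

    agree-aaa : ∀ i → J (atom i) (atom i) (atom i) ≡ J′ (atom i) (atom i) (atom i)
    agree-aaa i = +-cancelʳ′ refl (+-cancelʳ′ refl (relation-sums-agree (atom≤atom {i = i}) atom≤atom))

    agree-aat : ∀ i → J (atom i) (atom i) top ≡ J′ (atom i) (atom i) top
    agree-aat i = +-cancelʳ′ refl (+-cancelˡ′ (agree-aaa i)
      (+-cancelʳ′ refl (relation-sums-agree (atom≤atom {i = i}) ≤top)))

    agree-baa : ∀ i → J bot (atom i) (atom i) ≡ J′ bot (atom i) (atom i)
    agree-baa i = +-cancelʳ′ refl (+-cancelʳ′ (cong (λ w → (w + 0ℤ) + 0ℤ) (agree-aaa i))
      (relation-sums-agree bot≤ (atom≤atom {i = i})))

    agree-bat : ∀ i → J bot (atom i) top ≡ J′ bot (atom i) top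
    agree-bat i = +-cancelʳ′ refl (+-cancelˡ′ (agree-baa i)
      (+-cancelʳ′ (cong₂ (λ u v → (u + (v + 0ℤ)) + 0ℤ) (agree-aaa i) (agree-aat i))
        (relation-sums-agree (bot≤ {x = atom i}) ≤top)))

    agree-ttt : J top top top ≡ J′ top top top
    agree-ttt = +-cancelʳ′ refl (+-cancelʳ′ refl (relation-sums-agree (≤top {x = top}) ≤top))

    agree-att : ∀ i → J (atom i) top top ≡ J′ (atom i) top top
    agree-att i = +-cancelʳ′ refl (+-cancelʳ′ (cong (λ w → (w + 0ℤ) + 0ℤ) agree-ttt)
      (relation-sums-agree (≤top {x = atom i}) ≤top))

    agree-btt : J bot top top ≡ J′ bot top top
    agree-btt = +-cancelʳ′ refl (+-cancelʳ′ (cong₂ (λ u v → (u + 0ℤ) + v) agree-ttt atoms-agree)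
      (relation-sums-agree (bot≤ {x = top}) ≤top))
      where
      atoms-agree : sumL atoms (λ a → J a top top + 0ℤ) ≡ sumL atoms (λ a → J′ a top top + 0ℤ)
      atoms-agree = sumL-atoms-cong {f = λ a → J a top top + 0ℤ} {g = λ a → J′ a top top + 0ℤ}
                                    λ j → cong (_+ 0ℤ) (agree-att j)

    agree-on-flags : ∀ {x y z} → x ≤P y → y ≤P z → J x y z ≡ J′ x y z
    agree-on-flags {bot}    {bot}    {bot}    _         _         = agree-bbb
    agree-on-flags {bot}    {bot}    {atom i} _         _         = agree-bba i
    agree-on-flags {bot}    {bot}    {top}    _         _         = agree-bbt
    agree-on-flags {bot}    {atom i} {atom _} _         atom≤atom = agree-baa i
    agree-on-flags {bot}    {atom i} {top}    _         _         = agree-bat i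
    agree-on-flags {bot}    {top}    {top}    _         _         = agree-btt
    agree-on-flags {atom i} {atom _} {atom _} atom≤atom atom≤atom = agree-aaa i
    agree-on-flags {atom i} {atom _} {top}    atom≤atom _         = agree-aat i
    agree-on-flags {atom i} {top}    {top}    _         _         = agree-att i
    agree-on-flags {top}    {top}    {top}    _         _         = agree-ttt

  M-intervals : (J : PElt n → PElt n → PElt n → ℤ) (t : ℤ) →
    M (P n) J t ≡ sumL elems (λ x → sumL (interval x top) (λ y → sumL (interval y top) (λ z →
                    J x y z * t ^ (6 ∸ rkP x ∸ rkP y ∸ rkP z))))
  M-intervals J t = sumL-cong elems λ x → begin
    sumL elems (λ y → sumL elems (λ z → ζ x y * ζ y z * J x y z * T x y z))
      ≡⟨ sumL-cong elems (λ y → trans (sumL-cong elems (λ z → regroup (ζ x y) (ζ y z) (J x y z) (T x y z)))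
                                       (sumL-*ˡ elems (ζ x y) (λ z → ζ y z * (J x y z * T x y z)))) ⟩
    sumL elems (λ y → ζ x y * sumL elems (λ z → ζ y z * (J x y z * T x y z)))
      ≡⟨ sumL-cong elems (λ y → cong (ζ x y *_) (sumL-upset y (λ z → J x y z * T x y z))) ⟩
    sumL elems (λ y → ζ x y * sumL (interval y top) (λ z → J x y z * T x y z))
      ≡⟨ sumL-upset x _ ⟩
    sumL (interval x top) (λ y → sumL (interval y top) (λ z → J x y z * T x y z))
      ∎
    where
    T : PElt n → PElt n → PElt n → ℤ
    T x y z = t ^ (6 ∸ rkP x ∸ rkP y ∸ rkP z)
    regroup : ∀ a b c d → a * b * c * d ≡ a * (b * (c * d))
    regroup = solve-∀

  M-Jμ : ∀ t → M (P n) Jμ t ≡ (t ^ 2 - (+ n) * t + 1ℤ) * (t + 1ℤ) ^ 2 * (t - 1ℤ) ^ 2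
  M-Jμ t = begin
    M (P n) Jμ t
      ≡⟨ M-intervals Jμ t ⟩
    sumL elems X
      ≡⟨ sumL-elems X ⟩
    X bot + (X top + sumL atoms X)
      ≡⟨ cong₂ (λ u v → u + (X top + v)) X-bot (sumL-atoms-const X X-atom λ _ → refl) ⟩
    (1ℤ * t ^ 6 + (1ℤ * (+ n - 1ℤ) * t ^ 4 + + n * (-1ℤ * t ^ 5)))
      + ((+ n - 1ℤ) * 1ℤ * t ^ 2 + 0ℤ + + n * (-1ℤ * t ^ 4 + (1ℤ * t ^ 3 + 0ℤ)))
      + ((1ℤ * t ^ 0 + 0ℤ + 0ℤ) + + n * X-atom)
      ≡⟨ solve 2 (λ m t →
           (con 1ℤ :* t :^ 6 :+ (con 1ℤ :* (m :- con 1ℤ) :* t :^ 4 :+ m :* (con -1ℤ :* t :^ 5)))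
             :+ ((m :- con 1ℤ) :* con 1ℤ :* t :^ 2 :+ con 0ℤ
                 :+ m :* (con -1ℤ :* t :^ 4 :+ (con 1ℤ :* t :^ 3 :+ con 0ℤ)))
             :+ ((con 1ℤ :* t :^ 0 :+ con 0ℤ :+ con 0ℤ)
                 :+ m :* ((con 1ℤ :* t :^ 3 :+ (con -1ℤ :* t :^ 2 :+ con 0ℤ))
                          :+ (con -1ℤ :* t :^ 1 :+ con 0ℤ :+ con 0ℤ)))
           := (t :^ 2 :- m :* t :+ con 1ℤ) :* (t :+ con 1ℤ) :^ 2 :* (t :- con 1ℤ) :^ 2) refl (+ n) t ⟩
    (t ^ 2 - (+ n) * t + 1ℤ) * (t + 1ℤ) ^ 2 * (t - 1ℤ) ^ 2
      ∎
    where
    F : PElt n → PElt n → PElt n → ℤ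
    F x y z = Jμ x y z * t ^ (6 ∸ rkP x ∸ rkP y ∸ rkP z)
    X : PElt n → ℤ
    X x = sumL (interval x top) (λ y → sumL (interval y top) (F x y))
    X-atom : ℤ
    X-atom = (1ℤ * t ^ 3 + (-1ℤ * t ^ 2 + 0ℤ)) + (-1ℤ * t ^ 1 + 0ℤ + 0ℤ)
    X-bot : X bot ≡ (1ℤ * t ^ 6 + (1ℤ * (+ n - 1ℤ) * t ^ 4 + + n * (-1ℤ * t ^ 5)))
                    + ((+ n - 1ℤ) * 1ℤ * t ^ 2 + 0ℤ + + n * (-1ℤ * t ^ 4 + (1ℤ * t ^ 3 + 0ℤ)))
    X-bot = cong₂ (λ u v → (1ℤ * t ^ 6 + (1ℤ * (+ n - 1ℤ) * t ^ 4 + u)) + ((+ n - 1ℤ) * 1ℤ * t ^ 2 + 0ℤ + v))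
              (sumL-atoms-const (F bot bot) (-1ℤ * t ^ 5) λ _ → refl)
              (sumL-atoms-const (λ y → sumL (interval y top) (F bot y)) (-1ℤ * t ^ 4 + (1ℤ * t ^ 3 + 0ℤ)) λ _ → refl)

proposition6p9 : (n : ℕ) → 2 ≤ n →
    Σ (PElt n → PElt n → PElt n → ℤ) (IsJ (P n))
    × (∀ (J : PElt n → PElt n → PElt n → ℤ) → IsJ (P n) J → ∀ (t : ℤ) →
    M (P n) J t ≡ (t ^ 2 - (+ n) * t + 1ℤ) * (t + 1ℤ) ^ 2 * (t - 1ℤ) ^ 2)
proposition6p9 n _ = (Jμ , Jμ-isJ) , λ J isJ t →
  trans (M-cong-flags (P n) J Jμ (Uniqueness.agree-on-flags J Jμ isJ Jμ-isJ) t) (M-Jμ t)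
  where open RankTwo n
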